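{- Let $G$ be a $2$-connected simple graph on $[N]$ and let $e=uv$ be any edge of $G$. If $c\in\mathfrak{D}(G\setminus e)$, then $\beta(c):=(c,1)+e_u-e_{N+1}$ (equivalently, $(c,0)+e_u$) belongs to $\mathfrak{D}(G\mathbin{:}e)$. Moreover, $\beta:\mathfrak{D}(G\setminus e)\to\mathfrak{D}(G\mathbin{:}e)$ is injective.
   Context: Let $\mathcal{N}_G(i)$ denote the set of neighbors of $i$ in a graph $G$ on $[N]$. A sequence $(a_1,\dots,a_N)\in\mathbb{Z}_{\ge0}^N$ is $D(G)$-draconian if $\sum_i a_i=N-1$ and for every nonempty $S\subseteq[N]$, $\sum_{i\in S}a_i<\left|S\cup\bigcup_{i\in S}\mathcal{N}_G(i)\right|$; $\mathfrak{D}(G)$ is the set of such sequences. $G\setminus e$ is $G$ with the edge $e$ deleted (same vertex set $[N]$). $G\mathbin{:}e$ is the graph on $[N+1]$ with edge set $(E(G)\setminus\{uv\})\cup\{u(N+1),v(N+1)\}$. $e_1,\dots,e_{N+1}$ are the standard basis vectors of $\mathbb{R}^{N+1}$. -}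

module Defs where

open import Data.Nat using (ℕ; zero; suc; _+_; _∸_; _<_; _≤_)
open import Data.Fin using (Fin; zero; suc; inject₁; _≟_)
open import Data.Fin.Subset using (Subset; _∈_; Nonempty; ∣_∣)
open import Data.Bool using (Bool; true; false; _∧_; _∨_; not; if_then_else_)
open import Data.Vec using (Vec; []; _∷_; tabulate; lookup; zipWith; sum; _∷ʳ_)
open import Data.Maybe using (Maybe; just; nothing)
import Data.Maybe as Maybe
open import Data.Unit using (⊤)
open import Data.Product using (_×_)
open import Relation.Nullary using (¬_)
open import Relation.Nullary.Decidable using (⌊_⌋)
open import Relation.Binary.PropositionalEquality using (_≡_; _≢_)

Graph : ℕ → Set
Graph N = Fin N → Fin N → Bool

IsSimple : ∀ {N} → Graph N → Set
IsSimple {N} G = (∀ (i j : Fin N) → G i j ≡ G j i) × (∀ (i : Fin N) → G i i ≡ false)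

data Walk {N} (G : Graph N) (ok : Fin N → Set) : Fin N → Fin N → Set where
  here : ∀ {x} → ok x → Walk G ok x x
  step : ∀ {x y z} → ok x → G x y ≡ true → Walk G ok y z → Walk G ok x z

Connected : ∀ {N} → Graph N → Set
Connected {N} G = ∀ (x y : Fin N) → Walk G (λ _ → ⊤) x y

TwoConnected : ∀ {N} → Graph N → Set
TwoConnected {N} G =
  (3 ≤ N) × Connected G ×
  (∀ (w x y : Fin N) → x ≢ w → y ≢ w → Walk G (λ z → z ≢ w) x y)

isEdge : ∀ {N} → Fin N → Fin N → Fin N → Fin N → Bool
isEdge u v i j = (⌊ i ≟ u ⌋ ∧ ⌊ j ≟ v ⌋) ∨ (⌊ i ≟ v ⌋ ∧ ⌊ j ≟ u ⌋)

deleteEdge : ∀ {N} → Graph N → Fin N → Fin N → Graph N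
deleteEdge G u v i j = G i j ∧ not (isEdge u v i j)

-- old vertex (inject₁ a ↦ just a) or the new last vertex N+1 (↦ nothing)
old? : ∀ {N} → Fin (suc N) → Maybe (Fin N)
old? {zero} zero = nothing
old? {suc N} zero = just zero
old? {suc N} (suc i) = Maybe.map suc (old? i)

subdivide : ∀ {N} → Graph N → Fin N → Fin N → Graph (suc N)
subdivide G u v i j with old? i | old? j
... | just a  | just b  = deleteEdge G u v a b
... | just a  | nothing = ⌊ a ≟ u ⌋ ∨ ⌊ a ≟ v ⌋
... | nothing | just b  = ⌊ b ≟ u ⌋ ∨ ⌊ b ≟ v ⌋
... | nothing | nothing = false

sumOver : ∀ {N} → Subset N → Vec ℕ N → ℕ
sumOver S a = sum (zipWith (λ b x → if b then x else 0) S a)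

closedNbhd : ∀ {N} → Graph N → Subset N → Subset N
closedNbhd {N} G S =
  tabulate (λ j → lookup S j ∨ anyFin (λ i → lookup S i ∧ G i j))
  where
  anyFin : ∀ {n} → (Fin n → Bool) → Bool
  anyFin {zero} f = false
  anyFin {suc n} f = f zero ∨ anyFin (λ i → f (suc i))

Draconian : ∀ {N} → Graph N → Vec ℕ N → Set
Draconian {N} G a =
  (sum a ≡ N ∸ 1) ×
  (∀ (S : Subset N) → Nonempty S → sumOver S a < ∣ closedNbhd G S ∣)

basis : ∀ {n} → Fin n → Vec ℕ n
basis k = tabulate (λ i → if ⌊ i ≟ k ⌋ then 1 else 0)

β : ∀ {N} → Fin N → Vec ℕ N → Vec ℕ (suc N)
β u c = zipWith _+_ (c ∷ʳ 0) (basis (inject₁ u))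

module Submission where

-- Write a subset of the vertices of G : e as T ∷ʳ s, with T ⊆ [N] and s telling whether the new
-- vertex N+1 is in it. The weight of β(c) on T ∷ʳ s is the weight of c on T plus one exactly when
-- u ∈ T, while the closed neighbourhood of T ∷ʳ s in G : e contains that of T in G \ e (the old
-- vertices keep all adjacencies of G \ e) and also the new vertex as soon as s holds or u ∈ T.
-- So the strict Hall-type inequality for c transfers to β(c), the slack when u ∉ T but s holds
-- being paid for by the new vertex. Injectivity is cancellation of e_u.

open import Defs
open import Data.Nat using (ℕ; zero; suc; _+_; _<_; _≤_; z≤n; s≤s; _<?_)
open import Data.Nat.Properties
  using (+-commutativeSemigroup; +-comm; +-cancelʳ-≡; +-monoˡ-<; +-mono-≤-<; +-mono-≤; <⇒≤; ≤-refl; ≤-trans; ≮⇒≥;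
         module ≤-Reasoning)
open import Data.Fin using (Fin; zero; suc; inject₁; fromℕ; _≟_)
open import Data.Fin.Subset using (Subset; Nonempty; ∣_∣; ⊤)
open import Data.Fin.Subset.Properties using (p⊆q⇒∣p∣≤∣q∣)
open import Algebra.Properties.CommutativeSemigroup +-commutativeSemigroup
  using () renaming (interchange to +-interchange)
open import Data.Vec using (Vec; []; _∷_; lookup; tabulate; zipWith; sum; _∷ʳ_; initLast)
open import Data.Vec.Properties
  using (lookup∘tabulate; tabulate-cong; []=⇒lookup; lookup⇒[]=; ∷ʳ-injectiveˡ; ∷-injective;
         lookup-replicate)
open import Data.Vec.Base using (here; there)
open import Data.Bool using (Bool; true; false; _∧_; _∨_; if_then_else_)
open import Data.Bool.Properties using (∨-zeroʳ)
open import Data.Maybe using (just; nothing)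
open import Data.Product using (_×_; _,_; ∃)
open import Data.Sum using (_⊎_; inj₁; inj₂)
open import Relation.Nullary using (yes; no; contradiction)
open import Relation.Nullary.Decidable using (⌊_⌋; ⌊⌋-map′)
open import Relation.Binary.PropositionalEquality

𝟙 : Bool → ℕ
𝟙 b = if b then 1 else 0

lookup-∷ʳ-inject₁ : ∀ {A : Set} {n} (xs : Vec A n) y i → lookup (xs ∷ʳ y) (inject₁ i) ≡ lookup xs i
lookup-∷ʳ-inject₁ (x ∷ xs) y zero    = refl
lookup-∷ʳ-inject₁ (x ∷ xs) y (suc i) = lookup-∷ʳ-inject₁ xs y i

lookup-∷ʳ-fromℕ : ∀ {A : Set} {n} (xs : Vec A n) y → lookup (xs ∷ʳ y) (fromℕ n) ≡ y
lookup-∷ʳ-fromℕ []       y = refl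
lookup-∷ʳ-fromℕ (x ∷ xs) y = lookup-∷ʳ-fromℕ xs y

⊤-∷ʳ : ∀ n → ⊤ {suc n} ≡ ⊤ {n} ∷ʳ true
⊤-∷ʳ zero    = refl
⊤-∷ʳ (suc n) = cong (true ∷_) (⊤-∷ʳ n)

basis-suc : ∀ {n} (k : Fin n) → basis (suc k) ≡ 0 ∷ basis k
basis-suc k = cong (0 ∷_) (tabulate-cong λ i → cong 𝟙 (⌊⌋-map′ _ _ (i ≟ k)))

sumOver-⊤ : ∀ {n} (a : Vec ℕ n) → sumOver ⊤ a ≡ sum a
sumOver-⊤ []      = refl
sumOver-⊤ (x ∷ a) = cong (x +_) (sumOver-⊤ a)

sumOver-zipWith-+ : ∀ {n} (S : Subset n) (a b : Vec ℕ n) →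
  sumOver S (zipWith _+_ a b) ≡ sumOver S a + sumOver S b
sumOver-zipWith-+ []          []      []      = refl
sumOver-zipWith-+ (false ∷ S) (x ∷ a) (y ∷ b) = sumOver-zipWith-+ S a b
sumOver-zipWith-+ (true ∷ S)  (x ∷ a) (y ∷ b) =
  trans (cong (x + y +_) (sumOver-zipWith-+ S a b)) (+-interchange x y (sumOver S a) (sumOver S b))

sumOver-∷ʳ-0 : ∀ {n} (S : Subset n) s (a : Vec ℕ n) → sumOver (S ∷ʳ s) (a ∷ʳ 0) ≡ sumOver S a
sumOver-∷ʳ-0 []      true  []      = refl
sumOver-∷ʳ-0 []      false []      = refl
sumOver-∷ʳ-0 (t ∷ S) s     (x ∷ a) = cong ((if t then x else 0) +_) (sumOver-∷ʳ-0 S s a)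

sumOver-zeros : ∀ {n} (S : Subset n) → sumOver S (tabulate (λ _ → 0)) ≡ 0
sumOver-zeros []          = refl
sumOver-zeros (true ∷ S)  = sumOver-zeros S
sumOver-zeros (false ∷ S) = sumOver-zeros S

sumOver-basis : ∀ {n} (S : Subset n) k → sumOver S (basis k) ≡ 𝟙 (lookup S k)
sumOver-basis (true ∷ S)  zero    = cong suc (sumOver-zeros S)
sumOver-basis (false ∷ S) zero    = sumOver-zeros S
sumOver-basis (s ∷ S)     (suc k) = begin
  sumOver (s ∷ S) (basis (suc k))  ≡⟨ cong (sumOver (s ∷ S)) (basis-suc k) ⟩
  sumOver (s ∷ S) (0 ∷ basis k)    ≡⟨ cong (_+ sumOver S (basis k)) (if-0 s) ⟩
  sumOver S (basis k)              ≡⟨ sumOver-basis S k ⟩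
  𝟙 (lookup S k)                   ∎
  where
  open ≡-Reasoning
  if-0 : ∀ b → (if b then 0 else 0) ≡ 0
  if-0 true  = refl
  if-0 false = refl

sumOver-β : ∀ {N} (T : Subset N) s u (c : Vec ℕ N) →
  sumOver (T ∷ʳ s) (β u c) ≡ sumOver T c + 𝟙 (lookup T u)
sumOver-β T s u c = begin
  sumOver (T ∷ʳ s) (zipWith _+_ (c ∷ʳ 0) (basis (inject₁ u)))
    ≡⟨ sumOver-zipWith-+ (T ∷ʳ s) (c ∷ʳ 0) (basis (inject₁ u)) ⟩
  sumOver (T ∷ʳ s) (c ∷ʳ 0) + sumOver (T ∷ʳ s) (basis (inject₁ u))
    ≡⟨ cong₂ _+_ (sumOver-∷ʳ-0 T s c) (sumOver-basis (T ∷ʳ s) (inject₁ u)) ⟩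
  sumOver T c + 𝟙 (lookup (T ∷ʳ s) (inject₁ u))
    ≡⟨ cong (λ b → sumOver T c + 𝟙 b) (lookup-∷ʳ-inject₁ T s u) ⟩
  sumOver T c + 𝟙 (lookup T u)  ∎
  where open ≡-Reasoning

sum-β : ∀ {N} u (c : Vec ℕ N) → sum (β u c) ≡ suc (sum c)
sum-β {N} u c = begin
  sum (β u c)                              ≡⟨ sym (sumOver-⊤ (β u c)) ⟩
  sumOver ⊤ (β u c)                        ≡⟨ cong (λ S → sumOver S (β u c)) (⊤-∷ʳ N) ⟩
  sumOver (⊤ ∷ʳ true) (β u c)              ≡⟨ sumOver-β ⊤ true u c ⟩
  sumOver ⊤ c + 𝟙 (lookup (⊤ {N}) u)       ≡⟨ cong₂ (λ m b → m + 𝟙 b) (sumOver-⊤ c) (lookup-replicate u true) ⟩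
  sum c + 1                                ≡⟨ +-comm (sum c) 1 ⟩
  suc (sum c)                              ∎
  where open ≡-Reasoning

zipWith-+-cancelʳ : ∀ {n} (a b c : Vec ℕ n) → zipWith _+_ a c ≡ zipWith _+_ b c → a ≡ b
zipWith-+-cancelʳ []      []      []      eq = refl
zipWith-+-cancelʳ (x ∷ a) (y ∷ b) (z ∷ c) eq with ∷-injective eq
... | x+z≡y+z , rest = cong₂ _∷_ (+-cancelʳ-≡ z x y x+z≡y+z) (zipWith-+-cancelʳ a b c rest)

β-injective : ∀ {N} u (c c′ : Vec ℕ N) → β u c ≡ β u c′ → c ≡ c′
β-injective u c c′ eq = ∷ʳ-injectiveˡ c c′ (zipWith-+-cancelʳ (c ∷ʳ 0) (c′ ∷ʳ 0) _ eq)

-- The disjunction over S used inside closedNbhd is local to it, so it is reached by evaluating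
-- closedNbhd at a fresh vertex whose in-neighbours are the i with h i.
anyIn : ∀ {N} → Subset N → (Fin N → Bool) → Bool
anyIn {N} S h = lookup (closedNbhd {suc N} inNeighbours (false ∷ S)) zero
  where
  inNeighbours : Graph (suc N)
  inNeighbours zero    _ = false
  inNeighbours (suc i) _ = h i

anyIn⁺ : ∀ {N} (S : Subset N) h i → lookup S i ∧ h i ≡ true → anyIn S h ≡ true
anyIn⁺ (x ∷ S) h zero    eq = cong (_∨ anyIn S (λ i → h (suc i))) eq
anyIn⁺ (x ∷ S) h (suc i) eq =
  trans (cong ((x ∧ h zero) ∨_) (anyIn⁺ S (λ k → h (suc k)) i eq)) (∨-zeroʳ _)

anyIn⁻ : ∀ {N} (S : Subset N) h → anyIn S h ≡ true → ∃ λ i → lookup S i ∧ h i ≡ true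
anyIn⁻ (x ∷ S) h eq with x ∧ h zero in x∧h₀
... | true  = zero , x∧h₀
... | false with anyIn⁻ S (λ k → h (suc k)) eq
...   | i , p = suc i , p

lookup-closedNbhd : ∀ {N} (G : Graph N) S j →
  lookup (closedNbhd G S) j ≡ lookup S j ∨ anyIn S (λ i → G i j)
lookup-closedNbhd G S j = lookup∘tabulate _ j

closedNbhd⁺-self : ∀ {N} (G : Graph N) S j → lookup S j ≡ true → lookup (closedNbhd G S) j ≡ true
closedNbhd⁺-self G S j j∈S =
  trans (lookup-closedNbhd G S j) (cong (_∨ anyIn S (λ i → G i j)) j∈S)

closedNbhd⁺-adj : ∀ {N} (G : Graph N) S i j → lookup S i ∧ G i j ≡ true →
  lookup (closedNbhd G S) j ≡ true
closedNbhd⁺-adj G S i j ij =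
  trans (lookup-closedNbhd G S j) (trans (cong (lookup S j ∨_) (anyIn⁺ S _ i ij)) (∨-zeroʳ _))

∨-true⁻ : ∀ a b → a ∨ b ≡ true → a ≡ true ⊎ b ≡ true
∨-true⁻ true  b _   = inj₁ refl
∨-true⁻ false b b≡t = inj₂ b≡t

closedNbhd⁻ : ∀ {N} (G : Graph N) S j → lookup (closedNbhd G S) j ≡ true →
  lookup S j ≡ true ⊎ ∃ λ i → lookup S i ∧ G i j ≡ true
closedNbhd⁻ G S j j∈C with ∨-true⁻ _ _ (trans (sym (lookup-closedNbhd G S j)) j∈C)
... | inj₁ j∈S     = inj₁ j∈S
... | inj₂ adjToS = inj₂ (anyIn⁻ S _ adjToS)

old?-inject₁ : ∀ {N} (i : Fin N) → old? (inject₁ i) ≡ just i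
old?-inject₁ {suc N} zero    = refl
old?-inject₁ {suc N} (suc i) rewrite old?-inject₁ i = refl

old?-fromℕ : ∀ N → old? (fromℕ N) ≡ nothing
old?-fromℕ zero    = refl
old?-fromℕ (suc N) rewrite old?-fromℕ N = refl

subdivide-old-old : ∀ {N} (G : Graph N) u v i j →
  subdivide G u v (inject₁ i) (inject₁ j) ≡ deleteEdge G u v i j
subdivide-old-old G u v i j rewrite old?-inject₁ i | old?-inject₁ j = refl

subdivide-old-new : ∀ {N} (G : Graph N) u v i →
  subdivide G u v (inject₁ i) (fromℕ N) ≡ ⌊ i ≟ u ⌋ ∨ ⌊ i ≟ v ⌋
subdivide-old-new {N} G u v i rewrite old?-inject₁ i | old?-fromℕ N = refl

closedNbhd-subdivide-old : ∀ {N} (G : Graph N) u v T s j →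
  lookup (closedNbhd (deleteEdge G u v) T) j ≡ true →
  lookup (closedNbhd (subdivide G u v) (T ∷ʳ s)) (inject₁ j) ≡ true
closedNbhd-subdivide-old G u v T s j j∈C with closedNbhd⁻ (deleteEdge G u v) T j j∈C
... | inj₁ j∈T = closedNbhd⁺-self (subdivide G u v) (T ∷ʳ s) (inject₁ j)
                   (trans (lookup-∷ʳ-inject₁ T s j) j∈T)
... | inj₂ (i , ij) = closedNbhd⁺-adj (subdivide G u v) (T ∷ʳ s) (inject₁ i) (inject₁ j)
                   (trans (cong₂ _∧_ (lookup-∷ʳ-inject₁ T s i) (subdivide-old-old G u v i j)) ij)

closedNbhd-subdivide-new : ∀ {N} (G : Graph N) u v T s → s ∨ lookup T u ≡ true →
  lookup (closedNbhd (subdivide G u v) (T ∷ʳ s)) (fromℕ N) ≡ true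
closedNbhd-subdivide-new {N} G u v T s s∨u∈T with ∨-true⁻ s _ s∨u∈T
... | inj₁ s≡t = closedNbhd⁺-self (subdivide G u v) (T ∷ʳ s) (fromℕ N)
                   (trans (lookup-∷ʳ-fromℕ T s) s≡t)
... | inj₂ u∈T = closedNbhd⁺-adj (subdivide G u v) (T ∷ʳ s) (inject₁ u) (fromℕ N)
                   (trans (cong₂ _∧_ (lookup-∷ʳ-inject₁ T s u) (subdivide-old-new G u v u))
                          (cong₂ _∧_ u∈T (cong (λ u≟u → ⌊ u≟u ⌋ ∨ ⌊ u ≟ v ⌋) (≡-≟-identity _≟_ {u} refl))))

∣∷ʳ∣ : ∀ {n} (p : Subset n) b → ∣ p ∷ʳ b ∣ ≡ ∣ p ∣ + 𝟙 b
∣∷ʳ∣ []          true  = refl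
∣∷ʳ∣ []          false = refl
∣∷ʳ∣ (true ∷ p)  b     = cong suc (∣∷ʳ∣ p b)
∣∷ʳ∣ (false ∷ p) b     = ∣∷ʳ∣ p b

∣p∣≤∣q∣ : ∀ {n} (p q : Subset n) → (∀ i → lookup p i ≡ true → lookup q i ≡ true) → ∣ p ∣ ≤ ∣ q ∣
∣p∣≤∣q∣ p q p⊆q = p⊆q⇒∣p∣≤∣q∣ {p = p} λ {i} i∈p → lookup⇒[]= i q (p⊆q i ([]=⇒lookup {xs = p} i∈p))

∣p∣+𝟙≤∣q∣ : ∀ {n} (p : Subset n) (q : Subset (suc n)) b →
  (∀ j → lookup p j ≡ true → lookup q (inject₁ j) ≡ true) →
  (b ≡ true → lookup q (fromℕ n) ≡ true) →
  ∣ p ∣ + 𝟙 b ≤ ∣ q ∣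
∣p∣+𝟙≤∣q∣ {n} p q b old new with initLast q
... | r , y , refl = begin
  ∣ p ∣ + 𝟙 b   ≤⟨ +-mono-≤ (∣p∣≤∣q∣ p r old′) (𝟙-mono b y new′) ⟩
  ∣ r ∣ + 𝟙 y   ≡⟨ sym (∣∷ʳ∣ r y) ⟩
  ∣ r ∷ʳ y ∣    ∎
  where
  open ≤-Reasoning
  old′ : ∀ j → lookup p j ≡ true → lookup r j ≡ true
  old′ j j∈p = trans (sym (lookup-∷ʳ-inject₁ r y j)) (old j j∈p)
  new′ : b ≡ true → y ≡ true
  new′ b≡t = trans (sym (lookup-∷ʳ-fromℕ r y)) (new b≡t)
  𝟙-mono : ∀ b y → (b ≡ true → y ≡ true) → 𝟙 b ≤ 𝟙 y
  𝟙-mono true  y b⇒y rewrite b⇒y refl = ≤-refl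
  𝟙-mono false y _   = z≤n

∣closedNbhd-subdivide∣ : ∀ {N} (G : Graph N) u v T s →
  ∣ closedNbhd (deleteEdge G u v) T ∣ + 𝟙 (s ∨ lookup T u) ≤ ∣ closedNbhd (subdivide G u v) (T ∷ʳ s) ∣
∣closedNbhd-subdivide∣ G u v T s =
  ∣p∣+𝟙≤∣q∣ (closedNbhd (deleteEdge G u v) T) (closedNbhd (subdivide G u v) (T ∷ʳ s)) (s ∨ lookup T u)
    (closedNbhd-subdivide-old G u v T s) (closedNbhd-subdivide-new G u v T s)

Nonempty-∷ʳ : ∀ {n} (T : Subset n) s → Nonempty (T ∷ʳ s) → Nonempty T ⊎ s ≡ true
Nonempty-∷ʳ []      s (zero , here)      = inj₂ refl
Nonempty-∷ʳ (t ∷ T) s (zero , here)      = inj₁ (zero , here)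
Nonempty-∷ʳ (t ∷ T) s (suc i , there i∈) with Nonempty-∷ʳ T s (i , i∈)
... | inj₁ (j , j∈) = inj₁ (suc j , there j∈)
... | inj₂ s≡t      = inj₂ s≡t

sumOver-pos⇒Nonempty : ∀ {n} (S : Subset n) a → 0 < sumOver S a → Nonempty S
sumOver-pos⇒Nonempty []          []      ()
sumOver-pos⇒Nonempty (true ∷ S)  (x ∷ a) _   = zero , here
sumOver-pos⇒Nonempty (false ∷ S) (x ∷ a) pos with sumOver-pos⇒Nonempty S a pos
... | i , i∈S = suc i , there i∈S

sumOver-≤ : ∀ {n} (a : Vec ℕ n) (m : Subset n → ℕ) →
  (∀ S → Nonempty S → sumOver S a < m S) → ∀ S → sumOver S a ≤ m S
sumOver-≤ a m hall S with 0 <? sumOver S a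
... | yes pos  = <⇒≤ (hall S (sumOver-pos⇒Nonempty S a pos))
... | no ¬pos = ≤-trans (≮⇒≥ ¬pos) z≤n

a+𝟙b<k+𝟙[s∨b] : ∀ {a k} s b → (b ≡ true → a < k) → (s ≡ false → a < k) → a ≤ k →
  a + 𝟙 b < k + 𝟙 (s ∨ b)
a+𝟙b<k+𝟙[s∨b] true  true  b⇒< _ _   = +-monoˡ-< 1 (b⇒< refl)
a+𝟙b<k+𝟙[s∨b] false true  b⇒< _ _   = +-monoˡ-< 1 (b⇒< refl)
a+𝟙b<k+𝟙[s∨b] true  false _   _ a≤k = +-mono-≤-< a≤k (s≤s z≤n)
a+𝟙b<k+𝟙[s∨b] false false _ s⇒< _   = +-monoˡ-< 0 (s⇒< refl)

Draconian-subdivide : ∀ {N} (G : Graph N) u v (c : Vec ℕ N) →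
  Draconian (deleteEdge G u v) c → Draconian (subdivide G u v) (β u c)
Draconian-subdivide {suc n} G u v c (sum≡ , hall) = trans (sum-β u c) (cong suc sum≡) , hall′
  where
  H = deleteEdge G u v
  hall′ : ∀ S → Nonempty S → sumOver S (β u c) < ∣ closedNbhd (subdivide G u v) S ∣
  hall′ S ne with initLast S
  ... | T , s , refl = begin-strict
    sumOver (T ∷ʳ s) (β u c)                    ≡⟨ sumOver-β T s u c ⟩
    sumOver T c + 𝟙 (lookup T u)                <⟨ a+𝟙b<k+𝟙[s∨b] s (lookup T u)
                                                     (λ u∈T → hall T (u , lookup⇒[]= u T u∈T))
                                                     (λ s≡f → hall T (T-nonempty s≡f))
                                                     (sumOver-≤ c (λ S → ∣ closedNbhd H S ∣) hall T) ⟩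
    ∣ closedNbhd H T ∣ + 𝟙 (s ∨ lookup T u)      ≤⟨ ∣closedNbhd-subdivide∣ G u v T s ⟩
    ∣ closedNbhd (subdivide G u v) (T ∷ʳ s) ∣    ∎
    where
    open ≤-Reasoning
    T-nonempty : s ≡ false → Nonempty T
    T-nonempty s≡f with Nonempty-∷ʳ T s ne
    ... | inj₁ T≠∅ = T≠∅
    ... | inj₂ s≡t = contradiction (trans (sym s≡f) s≡t) λ ()

lemma3p7 : ∀ {N : ℕ} (G : Graph N) → IsSimple G → TwoConnected G →
    (u v : Fin N) → G u v ≡ true →
    (∀ (c : Vec ℕ N) → Draconian (deleteEdge G u v) c →
       Draconian (subdivide G u v) (β u c))
    × (∀ (c c′ : Vec ℕ N) → Draconian (deleteEdge G u v) c →
       Draconian (deleteEdge G u v) c′ → β u c ≡ β u c′ → c ≡ c′)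
lemma3p7 G _ _ u v _ = Draconian-subdivide G u v , λ c c′ _ _ → β-injective u c c′
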